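{- Let $p$ be an odd prime, $r\ge3$ an integer with $p\nmid r$, $D=\mathrm{D}_{2r}$, and let $G=V\rtimes_\psi D$ where $V=\mathbb{Z}_p^d$, $p\nmid|D|$, and $\psi$ is irreducible and non-trivial. Let $A=\mathrm{Aut}(G)$. Then $A=\mathrm{Inn}_G(V)\rtimes\mathrm{N}_A(D)$ and $\mathrm{Inn}_G(V)\cong V$.
   Context: $\mathrm{D}_{2r}$ is the dihedral group of order $2r$; $\psi:D\to\mathrm{GL}_d(\mathbb{F}_p)$ defines the action of $D$ on $V=\mathbb{F}_p^d$ in the semidirect product. For $g\in G$, $\tilde g$ is the inner automorphism $h\mapsto ghg^{ -1}$, and $\mathrm{Inn}_G(V)=\{\tilde v: v\in V\}$. $\mathrm{N}_A(D)$ is the set of automorphisms $f\in A$ with $f(D)=D$. -}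

module Defs where

open import Data.Nat using (ℕ; zero; suc; NonZero; _+_; _*_; _∸_)
open import Data.Nat.DivMod using (_%_; m%n<n)
open import Data.Fin using (Fin; toℕ; fromℕ<; _≟_)
open import Data.Bool using (Bool; true; false; _xor_; if_then_else_)
open import Data.Vec using (Vec; []; _∷_; zipWith; replicate; map; foldr′; tabulate; lookup)
open import Data.Product using (Σ; ∃; ∃-syntax; _×_; _,_)
open import Relation.Binary.PropositionalEquality
open import Relation.Nullary using (¬_; does)
open import Data.Sum using (_⊎_)
open import Level using (Level) renaming (suc to lsuc)

module ZMod (n : ℕ) .{{_ : NonZero n}} where
  Z : Set
  Z = Fin n

  reduce : ℕ → Z
  reduce k = fromℕ< (m%n<n k n)

  0z 1z : Z
  0z = reduce 0
  1z = reduce 1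

  _+z_ _*z_ : Z → Z → Z
  a +z b = reduce (toℕ a + toℕ b)
  a *z b = reduce (toℕ a * toℕ b)

  -z_ : Z → Z
  -z a = reduce (n ∸ toℕ a)

-- The dihedral group D_{2r} of order 2r: the pair (i , s) stands for
-- ρ^i σ^s, with ρ a rotation of order r and σ a reflection, σρσ⁻¹ = ρ⁻¹.

module Dihedral (r : ℕ) .{{_ : NonZero r}} where
  open ZMod r

  Dih : Set
  Dih = Z × Bool

  eD : Dih
  eD = (0z , false)

  _·D_ : Dih → Dih → Dih
  (i , s) ·D (j , t) = (i +z (if s then (-z j) else j)) , (s xor t)

  invD : Dih → Dih
  invD (i , false) = (-z i) , false
  invD (i , true)  = i , true

-- Vectors in V = 𝔽_p^d and d×d matrices over 𝔽_p (rows-first).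

module LinAlg (p : ℕ) .{{_ : NonZero p}} (d : ℕ) where
  open ZMod p

  V : Set
  V = Vec Z d

  Mat : Set
  Mat = Vec (Vec Z d) d

  sumZ : ∀ {k} → Vec Z k → Z
  sumZ = foldr′ _+z_ 0z

  _+V_ : V → V → V
  _+V_ = zipWith _+z_

  0V : V
  0V = replicate d 0z

  -V_ : V → V
  -V_ = map -z_

  _•V_ : Z → V → V
  c •V v = map (c *z_) v

  _⊙_ : Mat → V → V
  M ⊙ v = map (λ row → sumZ (zipWith _*z_ row v)) M

  column : Fin d → Mat → V
  column j N = map (λ row → lookup row j) N

  _·M_ : Mat → Mat → Mat
  M ·M N = map (λ row → tabulate (λ j → sumZ (zipWith _*z_ row (column j N)))) M

  IM : Mat
  IM = tabulate (λ i → tabulate (λ j → if does (i ≟ j) then 1z else 0z))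

  Invertible : Mat → Set
  Invertible M = Σ Mat (λ N → (M ·M N ≡ IM) × (N ·M M ≡ IM))

  record IsSubspace (W : V → Set) : Set where
    field
      zero∈ : W 0V
      +-closed : ∀ v w → W v → W w → W (v +V w)
      •-closed : ∀ c v → W v → W (c •V v)

module Rep (p : ℕ) .{{_ : NonZero p}} (d : ℕ) (r : ℕ) .{{_ : NonZero r}} where
  open ZMod p
  open LinAlg p d
  open Dihedral r

  IsHomToGL : (Dih → Mat) → Set
  IsHomToGL ψ = (∀ g → Invertible (ψ g)) × (∀ g h → ψ (g ·D h) ≡ ψ g ·M ψ h)

  Irreducible : (Dih → Mat) → Set₁
  Irreducible ψ = ∀ (W : V → Set) → IsSubspace W →
    (∀ g v → W v → W (ψ g ⊙ v)) →
    (∀ v → W v → v ≡ 0V) ⊎ (∀ v → W v)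

  NonTrivial : (Dih → Mat) → Set
  NonTrivial ψ = ¬ (∀ g → ψ g ≡ IM)

module SemiDirect (p : ℕ) .{{_ : NonZero p}} (d : ℕ) (r : ℕ) .{{_ : NonZero r}}
                  (ψ : Dihedral.Dih r → LinAlg.Mat p d) where
  open ZMod p
  open LinAlg p d
  open Dihedral r

  G : Set
  G = V × Dih

  _·_ : G → G → G
  (v , g) · (w , h) = (v +V (ψ g ⊙ w)) , (g ·D h)

  eG : G
  eG = 0V , eD

  invG : G → G
  invG (v , g) = (-V (ψ (invD g) ⊙ v)) , invD g

  ιV : V → G
  ιV v = v , eD

  ιD : Dih → G
  ιD g = 0V , g

  conj : G → G → G
  conj g x = (g · x) · invG g

  record Aut : Set where
    field
      fun : G → G
      inv : G → G
      inv-fun : ∀ x → inv (fun x) ≡ x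
      fun-inv : ∀ x → fun (inv x) ≡ x
      hom : ∀ x y → fun (x · y) ≡ fun x · fun y
  open Aut public

  _≈A_ : Aut → Aut → Set
  f ≈A g = ∀ x → fun f x ≡ fun g x

  idA : Aut
  idA = record { fun = λ x → x ; inv = λ x → x ; inv-fun = λ _ → refl
               ; fun-inv = λ _ → refl ; hom = λ _ _ → refl }

  _∘A_ : Aut → Aut → Aut
  f ∘A g = record
    { fun = λ x → fun f (fun g x)
    ; inv = λ x → inv g (inv f x)
    ; inv-fun = λ x → trans (cong (inv g) (inv-fun f (fun g x))) (inv-fun g x)
    ; fun-inv = λ x → trans (cong (fun f) (fun-inv g (inv f x))) (fun-inv f x)
    ; hom = λ x y → trans (cong (fun f) (hom g x y)) (hom f (fun g x) (fun g y))
    }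

  invA : Aut → Aut
  invA f = record
    { fun = inv f
    ; inv = fun f
    ; inv-fun = fun-inv f
    ; fun-inv = inv-fun f
    ; hom = λ x y → trans
        (cong (inv f) (trans (sym (cong₂ _·_ (fun-inv f x) (fun-inv f y)))
                             (sym (hom f (inv f x) (inv f y)))))
        (inv-fun f (inv f x · inv f y))
    }

  InnV : Aut → Set
  InnV f = Σ V (λ v → ∀ x → fun f x ≡ conj (ιV v) x)

  NormD : Aut → Set
  NormD f = (∀ g → ∃[ h ] fun f (ιD g) ≡ ιD h)
          × (∀ h → ∃[ g ] fun f (ιD g) ≡ ιD h)

  IsSubgroupA : (Aut → Set) → Set
  IsSubgroupA P = P idA × (∀ a b → P a → P b → P (a ∘A b)) × (∀ a → P a → P (invA a))

  IsNormalA : (Aut → Set) → Set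
  IsNormalA P = IsSubgroupA P × (∀ f a → P a → P ((f ∘A a) ∘A invA f))

  IsSemidirectA : (Aut → Set) → (Aut → Set) → Set
  IsSemidirectA N H =
      IsNormalA N
    × IsSubgroupA H
    × (∀ a → N a → H a → a ≈A idA)
    × (∀ f → Σ Aut (λ a → Σ Aut (λ b → N a × H b × (f ≈A (a ∘A b)))))

  InnV≅V : Set
  InnV≅V = Σ (V → Aut) (λ φ →
      (∀ v w → φ (v +V w) ≈A (φ v ∘A φ w))
    × (∀ v w → φ v ≈A φ w → v ≡ w)
    × (∀ v → InnV (φ v))
    × (∀ f → InnV f → Σ V (λ v → f ≈A φ v)))

-- Every automorphism f of G = V ⋊ D maps V into V: the image of v ∈ V satisfies x^(1+p) = x, and since
-- p is odd and prime to r, the only element of D with g^(1+p) = g is 1.  Hence Inn_G(V) is normal in A.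
-- Writing f(g) = (c g , φ g) for g ∈ D, the map c is a 1-cocycle of D with values in V (acting through
-- ψ ∘ φ); since |D| = 2r is invertible mod p, averaging exhibits c as the coboundary of some v, and then
-- f = ṽ ∘ b with b(D) = D.  Finally, if ṽ maps D onto D then v − ψ(g)v = 0 for all g, so v is a fixed
-- vector of ψ, which is 0 by irreducibility and non-triviality: this gives Inn_G(V) ∩ N_A(D) = 1 and the
-- injectivity of v ↦ ṽ.
module Submission where

open import Defs
open import Data.Nat as ℕ using (ℕ; zero; suc; NonZero; _+_; _*_; _∸_; _≤_)
import Data.Nat.Properties as ℕ
open import Data.Nat.DivMod
  using (_%_; _/_; m≡m%n+[m/n]*n; m%n<n; m<n⇒m%n≡m; %-distribˡ-+; %-distribˡ-*; [m+kn]%n≡m%n; [m+n]%n≡m%n)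
open import Data.Nat.Divisibility using (_∣_; divides)
open import Data.Nat.Primality using (Prime; prime⇒irreducible)
open import Data.Nat.Coprimality as Coprime using (Coprime; coprime-Bézout)
open import Data.Nat.GCD using (module Bézout)
open import Data.Fin as Fin using (Fin; toℕ; _≟_)
open import Data.Vec using (Vec; []; _∷_; lookup; tabulate; zipWith)
open import Data.Vec.Properties
  using (lookup-zipWith; lookup-map; lookup-replicate; lookup∘tabulate; tabulate∘lookup; tabulate-cong;
         zipWith-assoc; zipWith-comm; zipWith-identityˡ; zipWith-identityʳ; zipWith-inverseˡ; zipWith-inverseʳ)
open import Data.Fin.Properties using (toℕ-injective; toℕ-fromℕ<; fromℕ<-cong; toℕ<n)
open import Data.Product using (Σ; ∃-syntax; _×_; _,_; proj₁; proj₂)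
open import Algebra.Bundles using (CommutativeRing; AbelianGroup)
import Algebra.Properties.Semiring.Sum as SemiringSum
open import Level using (0ℓ)
open import Data.Fin.Permutation using (permutation)
open import Data.Sum using (_⊎_; inj₁; inj₂)
open import Data.Empty using (⊥-elim)
open import Data.Bool using (true; false; _xor_; if_then_else_)
open import Relation.Nullary using (¬_; does)
open import Relation.Binary.PropositionalEquality

≡-by-lookup : ∀ {A : Set} {n} {xs ys : Vec A n} → (∀ i → lookup xs i ≡ lookup ys i) → xs ≡ ys
≡-by-lookup {xs = xs} {ys} eq = trans (sym (tabulate∘lookup xs)) (trans (tabulate-cong eq) (tabulate∘lookup ys))

-- power⁺ _∙_ x k is x ∙ x ∙ ⋯ ∙ x with 1 + k factors; it needs no unit.
power⁺ : {A : Set} → (A → A → A) → A → ℕ → A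
power⁺ _∙_ x zero    = x
power⁺ _∙_ x (suc k) = x ∙ power⁺ _∙_ x k

power⁺-homo : {A B : Set} {_∙_ : A → A → A} {_∘_ : B → B → B} (f : A → B) →
              (∀ x y → f (x ∙ y) ≡ f x ∘ f y) → ∀ x k → f (power⁺ _∙_ x k) ≡ power⁺ _∘_ (f x) k
power⁺-homo f homo x zero    = refl
power⁺-homo {_∘_ = _∘_} f homo x (suc k) = trans (homo x _) (cong (f x ∘_) (power⁺-homo f homo x k))

prime∤⇒coprime : ∀ {p m} → Prime p → ¬ (p ∣ m) → Coprime p m
prime∤⇒coprime p-prime p∤m (i∣p , i∣m) with prime⇒irreducible p-prime i∣p
... | inj₁ i≡1 = i≡1
... | inj₂ refl = ⊥-elim (p∤m i∣m)

odd-prime : ∀ {p} → Prime p → ¬ (p ≡ 2) → ∃[ q ] p ≡ suc (q * 2)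
odd-prime {p} p-prime p≢2 with p % 2 | m%n<n p 2 | m≡m%n+[m/n]*n p 2
... | zero        | _                 | p≡[p/2]*2 = ⊥-elim (p≢2 (two-divides (prime⇒irreducible p-prime (divides (p / 2) p≡[p/2]*2))))
  where
  two-divides : 2 ≡ 1 ⊎ 2 ≡ p → p ≡ 2
  two-divides (inj₂ 2≡p) = sym 2≡p
... | suc zero    | _                 | p≡1+[p/2]*2 = p / 2 , p≡1+[p/2]*2
... | suc (suc _) | ℕ.s≤s (ℕ.s≤s ()) | _

module ZModProperties (n : ℕ) .{{_ : NonZero n}} where
  open ZMod n
  open ≡-Reasoning

  toℕ-reduce : ∀ k → toℕ (reduce k) ≡ k % n
  toℕ-reduce k = toℕ-fromℕ< (m%n<n k n)

  reduce-cong : ∀ {x y} → x % n ≡ y % n → reduce x ≡ reduce y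
  reduce-cong {x} {y} eq = fromℕ<-cong _ _ eq (m%n<n x n) (m%n<n y n)

  reduce-toℕ : ∀ a → reduce (toℕ a) ≡ a
  reduce-toℕ a = toℕ-injective (trans (toℕ-reduce (toℕ a)) (m<n⇒m%n≡m (toℕ<n a)))

  reduce-+ : ∀ x y → reduce (x + y) ≡ reduce x +z reduce y
  reduce-+ x y = reduce-cong (begin
    (x + y) % n                             ≡⟨ %-distribˡ-+ x y n ⟩
    (x % n + y % n) % n                     ≡⟨ cong₂ (λ a b → (a + b) % n) (sym (toℕ-reduce x)) (sym (toℕ-reduce y)) ⟩
    (toℕ (reduce x) + toℕ (reduce y)) % n   ∎)

  reduce-* : ∀ x y → reduce (x * y) ≡ reduce x *z reduce y
  reduce-* x y = reduce-cong (begin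
    (x * y) % n                             ≡⟨ %-distribˡ-* x y n ⟩
    (x % n * (y % n)) % n                   ≡⟨ cong₂ (λ a b → (a * b) % n) (sym (toℕ-reduce x)) (sym (toℕ-reduce y)) ⟩
    (toℕ (reduce x) * toℕ (reduce y)) % n   ∎)

  reduce-n : reduce n ≡ 0z
  reduce-n = reduce-cong ([m+n]%n≡m%n 0 n)

  -- Each ring law is transported from ℕ along the surjection reduce.
  +z-comm : ∀ a b → a +z b ≡ b +z a
  +z-comm a b = cong reduce (ℕ.+-comm (toℕ a) (toℕ b))

  *z-comm : ∀ a b → a *z b ≡ b *z a
  *z-comm a b = cong reduce (ℕ.*-comm (toℕ a) (toℕ b))

  +z-assoc : ∀ a b c → (a +z b) +z c ≡ a +z (b +z c)
  +z-assoc a b c = begin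
    (a +z b) +z c                   ≡⟨ cong ((a +z b) +z_) (sym (reduce-toℕ c)) ⟩
    (a +z b) +z reduce (toℕ c)      ≡⟨ sym (reduce-+ (toℕ a + toℕ b) (toℕ c)) ⟩
    reduce (toℕ a + toℕ b + toℕ c)  ≡⟨ cong reduce (ℕ.+-assoc (toℕ a) (toℕ b) (toℕ c)) ⟩
    reduce (toℕ a + (toℕ b + toℕ c)) ≡⟨ reduce-+ (toℕ a) (toℕ b + toℕ c) ⟩
    reduce (toℕ a) +z (b +z c)      ≡⟨ cong (_+z (b +z c)) (reduce-toℕ a) ⟩
    a +z (b +z c)                   ∎

  *z-assoc : ∀ a b c → (a *z b) *z c ≡ a *z (b *z c)
  *z-assoc a b c = begin
    (a *z b) *z c                   ≡⟨ cong ((a *z b) *z_) (sym (reduce-toℕ c)) ⟩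
    (a *z b) *z reduce (toℕ c)      ≡⟨ sym (reduce-* (toℕ a * toℕ b) (toℕ c)) ⟩
    reduce (toℕ a * toℕ b * toℕ c)  ≡⟨ cong reduce (ℕ.*-assoc (toℕ a) (toℕ b) (toℕ c)) ⟩
    reduce (toℕ a * (toℕ b * toℕ c)) ≡⟨ reduce-* (toℕ a) (toℕ b * toℕ c) ⟩
    reduce (toℕ a) *z (b *z c)      ≡⟨ cong (_*z (b *z c)) (reduce-toℕ a) ⟩
    a *z (b *z c)                   ∎

  *z-distribˡ-+z : ∀ a b c → a *z (b +z c) ≡ (a *z b) +z (a *z c)
  *z-distribˡ-+z a b c = begin
    a *z (b +z c)                        ≡⟨ cong (_*z (b +z c)) (sym (reduce-toℕ a)) ⟩
    reduce (toℕ a) *z (b +z c)           ≡⟨ sym (reduce-* (toℕ a) (toℕ b + toℕ c)) ⟩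
    reduce (toℕ a * (toℕ b + toℕ c))     ≡⟨ cong reduce (ℕ.*-distribˡ-+ (toℕ a) (toℕ b) (toℕ c)) ⟩
    reduce (toℕ a * toℕ b + toℕ a * toℕ c) ≡⟨ reduce-+ (toℕ a * toℕ b) (toℕ a * toℕ c) ⟩
    (a *z b) +z (a *z c)                 ∎

  *z-distribʳ-+z : ∀ a b c → (b +z c) *z a ≡ (b *z a) +z (c *z a)
  *z-distribʳ-+z a b c = begin
    (b +z c) *z a         ≡⟨ *z-comm (b +z c) a ⟩
    a *z (b +z c)         ≡⟨ *z-distribˡ-+z a b c ⟩
    (a *z b) +z (a *z c)  ≡⟨ cong₂ _+z_ (*z-comm a b) (*z-comm a c) ⟩
    (b *z a) +z (c *z a)  ∎

  +z-identityˡ : ∀ a → 0z +z a ≡ a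
  +z-identityˡ a = begin
    0z +z a                ≡⟨ cong (0z +z_) (sym (reduce-toℕ a)) ⟩
    0z +z reduce (toℕ a)   ≡⟨ sym (reduce-+ 0 (toℕ a)) ⟩
    reduce (toℕ a)         ≡⟨ reduce-toℕ a ⟩
    a                      ∎

  +z-identityʳ : ∀ a → a +z 0z ≡ a
  +z-identityʳ a = trans (+z-comm a 0z) (+z-identityˡ a)

  *z-identityˡ : ∀ a → 1z *z a ≡ a
  *z-identityˡ a = begin
    1z *z a                ≡⟨ cong (1z *z_) (sym (reduce-toℕ a)) ⟩
    1z *z reduce (toℕ a)   ≡⟨ sym (reduce-* 1 (toℕ a)) ⟩
    reduce (1 * toℕ a)     ≡⟨ cong reduce (ℕ.*-identityˡ (toℕ a)) ⟩
    reduce (toℕ a)         ≡⟨ reduce-toℕ a ⟩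
    a                      ∎

  *z-identityʳ : ∀ a → a *z 1z ≡ a
  *z-identityʳ a = trans (*z-comm a 1z) (*z-identityˡ a)

  -z-inverseʳ : ∀ a → a +z (-z a) ≡ 0z
  -z-inverseʳ a = begin
    a +z (-z a)                  ≡⟨ cong (_+z (-z a)) (sym (reduce-toℕ a)) ⟩
    reduce (toℕ a) +z (-z a)     ≡⟨ sym (reduce-+ (toℕ a) (n ∸ toℕ a)) ⟩
    reduce (toℕ a + (n ∸ toℕ a)) ≡⟨ cong reduce (ℕ.m+[n∸m]≡n (ℕ.<⇒≤ (toℕ<n a))) ⟩
    reduce n                     ≡⟨ reduce-n ⟩
    0z                           ∎

  -z-inverseˡ : ∀ a → (-z a) +z a ≡ 0z
  -z-inverseˡ a = trans (+z-comm (-z a) a) (-z-inverseʳ a)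

  commutativeRing : CommutativeRing 0ℓ 0ℓ
  commutativeRing = record
    { Carrier = Z ; _≈_ = _≡_ ; _+_ = _+z_ ; _*_ = _*z_ ; -_ = -z_ ; 0# = 0z ; 1# = 1z
    ; isCommutativeRing = record
      { isRing = record
        { +-isAbelianGroup = record
          { isGroup = record
            { isMonoid = record
              { isSemigroup = record
                { isMagma = record { isEquivalence = isEquivalence ; ∙-cong = cong₂ _+z_ }
                ; assoc = +z-assoc }
              ; identity = +z-identityˡ , +z-identityʳ }
            ; inverse = -z-inverseˡ , -z-inverseʳ
            ; ⁻¹-cong = cong -z_ }
          ; comm = +z-comm }
        ; *-cong = cong₂ _*z_
        ; *-assoc = *z-assoc
        ; *-identity = *z-identityˡ , *z-identityʳ
        ; distrib = *z-distribˡ-+z , *z-distribʳ-+z }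
      ; *-comm = *z-comm } }

  open import Algebra.Properties.Ring (CommutativeRing.ring commutativeRing) using (-‿distribˡ-*; -‿involutive; +-inverseʳ-unique)

  x-[x-y]≡y : ∀ i j → i +z (-z (i +z (-z j))) ≡ j
  x-[x-y]≡y i j = begin
    i +z (-z (i +z (-z j)))  ≡⟨ cong (i +z_) (⁻¹-anti-homo‿- i j) ⟩
    i +z (j +z (-z i))       ≡⟨ sym (+z-assoc i j (-z i)) ⟩
    (i +z j) +z (-z i)       ≡⟨ xyx⁻¹≈y i j ⟩
    j                        ∎
    where open import Algebra.Properties.AbelianGroup (CommutativeRing.+-abelianGroup commutativeRing) using (⁻¹-anti-homo‿-; xyx⁻¹≈y)

  reduce-suc-* : ∀ k a → reduce (suc k) *z a ≡ a +z (reduce k *z a)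
  reduce-suc-* k a = begin
    reduce (1 + k) *z a             ≡⟨ cong (_*z a) (reduce-+ 1 k) ⟩
    (1z +z reduce k) *z a           ≡⟨ *z-distribʳ-+z a 1z (reduce k) ⟩
    (1z *z a) +z (reduce k *z a)    ≡⟨ cong (_+z (reduce k *z a)) (*z-identityˡ a) ⟩
    a +z (reduce k *z a)            ∎

  coprime⇒invertible : ∀ {m} → Coprime m n → ∃[ z ] z *z reduce m ≡ 1z
  coprime⇒invertible {m} c with coprime-Bézout c
  ... | Bézout.+- x y eq = reduce x , (begin
    reduce x *z reduce m  ≡⟨ sym (reduce-* x m) ⟩
    reduce (x * m)        ≡⟨ cong reduce (sym eq) ⟩
    reduce (1 + y * n)    ≡⟨ reduce-cong ([m+kn]%n≡m%n 1 y n) ⟩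
    1z                    ∎)
  ... | Bézout.-+ x y eq = -z reduce x , (begin
    (-z reduce x) *z reduce m  ≡⟨ sym (-‿distribˡ-* (reduce x) (reduce m)) ⟩
    -z (reduce x *z reduce m)  ≡⟨ cong -z_ (sym (reduce-* x m)) ⟩
    -z reduce (x * m)          ≡⟨ cong -z_ (+-inverseʳ-unique 1z (reduce (x * m)) 1+xm≡0) ⟩
    -z (-z 1z)                 ≡⟨ -‿involutive 1z ⟩
    1z                         ∎)
    where
    1+xm≡0 : 1z +z reduce (x * m) ≡ 0z
    1+xm≡0 = begin
      1z +z reduce (x * m)  ≡⟨ sym (reduce-+ 1 (x * m)) ⟩
      reduce (1 + x * m)    ≡⟨ cong reduce eq ⟩
      reduce (y * n)        ≡⟨ reduce-cong ([m+kn]%n≡m%n 0 y n) ⟩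
      0z                    ∎

module DihedralProperties (r : ℕ) .{{_ : NonZero r}} where
  open Dihedral r
  open ZMod r
  open ZModProperties r
  open CommutativeRing commutativeRing using (+-group; zeroʳ)
  open import Algebra.Properties.Group +-group using (ε⁻¹≈ε; identityʳ-unique)
  open ≡-Reasoning

  ·D-identityˡ : ∀ g → eD ·D g ≡ g
  ·D-identityˡ (j , t) = cong (_, t) (+z-identityˡ j)

  invD-eD : invD eD ≡ eD
  invD-eD = cong (_, false) ε⁻¹≈ε

  ·D-identityʳ : ∀ g → g ·D eD ≡ g
  ·D-identityʳ (i , false) = cong (_, false) (+z-identityʳ i)
  ·D-identityʳ (i , true)  = cong (_, true) (trans (cong (i +z_) ε⁻¹≈ε) (+z-identityʳ i))

  reflection-involutive : ∀ i → (i , true) ·D (i , true) ≡ eD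
  reflection-involutive i = cong (_, false) (-z-inverseʳ i)

  reflection-cancel : ∀ i g → (i , true) ·D ((i , true) ·D g) ≡ g
  reflection-cancel i (j , t) = cong₂ _,_ (x-[x-y]≡y i j) (xor-cancel t)
    where
    xor-cancel : ∀ t → true xor (true xor t) ≡ t
    xor-cancel false = refl
    xor-cancel true  = refl

  rotation-power⁺ : ∀ i k → power⁺ _·D_ (i , false) k ≡ (reduce (suc k) *z i , false)
  rotation-power⁺ i zero    = cong (_, false) (sym (*z-identityˡ i))
  rotation-power⁺ i (suc k) =
    trans (cong ((i , false) ·D_) (rotation-power⁺ i k)) (cong (_, false) (sym (reduce-suc-* (suc k) i)))

  reflection-power⁺-odd : ∀ i q → power⁺ _·D_ (i , true) (suc (q * 2)) ≡ eD
  reflection-power⁺-odd i zero    = reflection-involutive i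
  reflection-power⁺-odd i (suc q) =
    trans (reflection-cancel i (power⁺ _·D_ (i , true) (suc (q * 2)))) (reflection-power⁺-odd i q)

  power⁺-fixed⇒eD : ∀ {k} → Coprime k r → ∃[ q ] k ≡ suc (q * 2) →
                    ∀ g → power⁺ _·D_ g k ≡ g → g ≡ eD
  power⁺-fixed⇒eD _ (q , refl) (i , true) fixed with trans (sym fixed) (reflection-power⁺-odd i q)
  ... | ()
  power⁺-fixed⇒eD {k} k⊥r _ (i , false) fixed = cong (_, false) i≡0
    where
    z : Z
    z = proj₁ (coprime⇒invertible k⊥r)
    ki≡0 : reduce k *z i ≡ 0z
    ki≡0 = identityʳ-unique i (reduce k *z i)
      (trans (sym (reduce-suc-* k i)) (cong proj₁ (trans (sym (rotation-power⁺ i k)) fixed)))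
    i≡0 : i ≡ 0z
    i≡0 = begin
      i                     ≡⟨ sym (*z-identityˡ i) ⟩
      1z *z i               ≡⟨ cong (_*z i) (sym (proj₂ (coprime⇒invertible k⊥r))) ⟩
      (z *z reduce k) *z i  ≡⟨ *z-assoc z (reduce k) i ⟩
      z *z (reduce k *z i)  ≡⟨ cong (z *z_) ki≡0 ⟩
      z *z 0z               ≡⟨ zeroʳ z ⟩
      0z                    ∎

module LinAlgProperties (p : ℕ) .{{_ : NonZero p}} (d : ℕ) where
  open ZMod p
  open ZModProperties p
  open LinAlg p d
  open CommutativeRing commutativeRing using (semiring; zeroˡ)
  open ≡-Reasoning

  abelianGroup : AbelianGroup 0ℓ 0ℓ
  abelianGroup = record
    { Carrier = V ; _≈_ = _≡_ ; _∙_ = _+V_ ; ε = 0V ; _⁻¹ = -V_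
    ; isAbelianGroup = record
      { isGroup = record
        { isMonoid = record
          { isSemigroup = record
            { isMagma = record { isEquivalence = isEquivalence ; ∙-cong = cong₂ _+V_ }
            ; assoc = zipWith-assoc +z-assoc }
          ; identity = zipWith-identityˡ +z-identityˡ , zipWith-identityʳ +z-identityʳ }
        ; inverse = zipWith-inverseˡ -z-inverseˡ , zipWith-inverseʳ -z-inverseʳ
        ; ⁻¹-cong = cong -V_ }
      ; comm = zipWith-comm +z-comm } }

  open AbelianGroup abelianGroup public using () renaming
    (assoc to +V-assoc; comm to +V-comm; identityˡ to +V-identityˡ; identityʳ to +V-identityʳ;
     inverseˡ to +V-inverseˡ; inverseʳ to +V-inverseʳ)
  open import Algebra.Properties.Group (AbelianGroup.group abelianGroup) using (identityʳ-unique; inverseʳ-unique; x∙y⁻¹≈ε⇒x≈y)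

  IsAdditive : (V → V) → Set
  IsAdditive h = ∀ u w → h (u +V w) ≡ h u +V h w

  additive⇒0V : ∀ {h} → IsAdditive h → h 0V ≡ 0V
  additive⇒0V {h} additive =
    identityʳ-unique (h 0V) (h 0V) (trans (sym (additive 0V 0V)) (cong h (+V-identityˡ 0V)))

  additive⇒-V : ∀ {h} → IsAdditive h → ∀ v → h (-V v) ≡ -V h v
  additive⇒-V {h} additive v =
    inverseʳ-unique (h v) (h (-V v)) (trans (sym (additive v (-V v))) (trans (cong h (+V-inverseʳ v)) (additive⇒0V additive)))

  open SemiringSum semiring using (sum; sum-cong-≗; sum-replicate-zero; ∑-distrib-+; ∑-comm; *-distribˡ-sum; *-distribʳ-sum)

  entry : Mat → Fin d → Fin d → Z
  entry M i j = lookup (lookup M i) j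

  δ : ∀ {m} → Fin m → Fin m → Z
  δ i j = if does (i ≟ j) then 1z else 0z

  sumZ-zipWith : ∀ {k} (a b : Vec Z k) → sumZ (zipWith _*z_ a b) ≡ sum (λ j → lookup a j *z lookup b j)
  sumZ-zipWith []      []      = refl
  sumZ-zipWith (x ∷ a) (y ∷ b) = cong ((x *z y) +z_) (sumZ-zipWith a b)

  lookup-⊙ : ∀ M v i → lookup (M ⊙ v) i ≡ sum (λ j → entry M i j *z lookup v j)
  lookup-⊙ M v i = trans (lookup-map i _ M) (sumZ-zipWith (lookup M i) v)

  entry-·M : ∀ M N i j → entry (M ·M N) i j ≡ sum (λ k → entry M i k *z entry N k j)
  entry-·M M N i j = begin
    entry (M ·M N) i j                                         ≡⟨ cong (λ row → lookup row j) (lookup-map i _ M) ⟩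
    lookup (tabulate (λ j → sumZ (zipWith _*z_ (lookup M i) (column j N)))) j ≡⟨ lookup∘tabulate _ j ⟩
    sumZ (zipWith _*z_ (lookup M i) (column j N))              ≡⟨ sumZ-zipWith (lookup M i) (column j N) ⟩
    sum (λ k → entry M i k *z lookup (column j N) k)           ≡⟨ sum-cong-≗ (λ k → cong (entry M i k *z_) (lookup-map k _ N)) ⟩
    sum (λ k → entry M i k *z entry N k j)                     ∎

  entry-IM : ∀ i j → entry IM i j ≡ δ i j
  entry-IM i j = trans (cong (λ row → lookup row j) (lookup∘tabulate _ i)) (lookup∘tabulate _ j)

  sum-δ : ∀ {m} (i : Fin m) (f : Fin m → Z) → sum (λ j → δ i j *z f j) ≡ f i
  sum-δ {suc m} Fin.zero f = begin
    (1z *z f Fin.zero) +z sum {m} (λ j → 0z *z f (Fin.suc j))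
      ≡⟨ cong₂ _+z_ (*z-identityˡ _) (sum-cong-≗ (λ j → zeroˡ (f (Fin.suc j)))) ⟩
    f Fin.zero +z sum {m} (λ _ → 0z)
      ≡⟨ cong (f Fin.zero +z_) (sum-replicate-zero m) ⟩
    f Fin.zero +z 0z
      ≡⟨ +z-identityʳ _ ⟩
    f Fin.zero ∎
  sum-δ {suc m} (Fin.suc i) f =
    trans (cong₂ _+z_ (zeroˡ (f Fin.zero)) (sum-δ i (λ j → f (Fin.suc j)))) (+z-identityˡ (f (Fin.suc i)))

  ⊙-distrib-+V : ∀ M u w → M ⊙ (u +V w) ≡ (M ⊙ u) +V (M ⊙ w)
  ⊙-distrib-+V M u w = ≡-by-lookup λ i → begin
    lookup (M ⊙ (u +V w)) i
      ≡⟨ lookup-⊙ M (u +V w) i ⟩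
    sum (λ j → entry M i j *z lookup (u +V w) j)
      ≡⟨ sum-cong-≗ (λ j → trans (cong (entry M i j *z_) (lookup-zipWith _+z_ j u w))
                                  (*z-distribˡ-+z (entry M i j) (lookup u j) (lookup w j))) ⟩
    sum (λ j → (entry M i j *z lookup u j) +z (entry M i j *z lookup w j))
      ≡⟨ ∑-distrib-+ (λ j → entry M i j *z lookup u j) (λ j → entry M i j *z lookup w j) ⟩
    sum (λ j → entry M i j *z lookup u j) +z sum (λ j → entry M i j *z lookup w j)
      ≡⟨ sym (cong₂ _+z_ (lookup-⊙ M u i) (lookup-⊙ M w i)) ⟩
    lookup (M ⊙ u) i +z lookup (M ⊙ w) i
      ≡⟨ sym (lookup-zipWith _+z_ i (M ⊙ u) (M ⊙ w)) ⟩
    lookup ((M ⊙ u) +V (M ⊙ w)) i ∎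

  ⊙-•V : ∀ M c u → M ⊙ (c •V u) ≡ c •V (M ⊙ u)
  ⊙-•V M c u = ≡-by-lookup λ i → begin
    lookup (M ⊙ (c •V u)) i
      ≡⟨ lookup-⊙ M (c •V u) i ⟩
    sum (λ j → entry M i j *z lookup (c •V u) j)
      ≡⟨ sum-cong-≗ (λ j → trans (cong (entry M i j *z_) (lookup-map j (c *z_) u)) (swap (entry M i j) c (lookup u j))) ⟩
    sum (λ j → c *z (entry M i j *z lookup u j))
      ≡⟨ sym (*-distribˡ-sum c (λ j → entry M i j *z lookup u j)) ⟩
    c *z sum (λ j → entry M i j *z lookup u j)
      ≡⟨ cong (c *z_) (sym (lookup-⊙ M u i)) ⟩
    c *z lookup (M ⊙ u) i
      ≡⟨ sym (lookup-map i (c *z_) (M ⊙ u)) ⟩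
    lookup (c •V (M ⊙ u)) i ∎
    where
    open import Algebra.Properties.CommutativeSemigroup (CommutativeRing.*-commutativeSemigroup commutativeRing)
      using () renaming (x∙yz≈y∙xz to swap)

  ·M-⊙ : ∀ M N v → (M ·M N) ⊙ v ≡ M ⊙ (N ⊙ v)
  ·M-⊙ M N v = ≡-by-lookup λ i → begin
    lookup ((M ·M N) ⊙ v) i
      ≡⟨ lookup-⊙ (M ·M N) v i ⟩
    sum (λ j → entry (M ·M N) i j *z lookup v j)
      ≡⟨ sum-cong-≗ (λ j → trans (cong (_*z lookup v j) (entry-·M M N i j))
                                  (*-distribʳ-sum (lookup v j) (λ k → entry M i k *z entry N k j))) ⟩
    sum (λ j → sum (λ k → (entry M i k *z entry N k j) *z lookup v j))
      ≡⟨ ∑-comm (λ j k → (entry M i k *z entry N k j) *z lookup v j) ⟩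
    sum (λ k → sum (λ j → (entry M i k *z entry N k j) *z lookup v j))
      ≡⟨ sum-cong-≗ (λ k → trans (sum-cong-≗ (λ j → *z-assoc (entry M i k) (entry N k j) (lookup v j)))
                                  (sym (*-distribˡ-sum (entry M i k) (λ j → entry N k j *z lookup v j)))) ⟩
    sum (λ k → entry M i k *z sum (λ j → entry N k j *z lookup v j))
      ≡⟨ sum-cong-≗ (λ k → cong (entry M i k *z_) (sym (lookup-⊙ N v k))) ⟩
    sum (λ k → entry M i k *z lookup (N ⊙ v) k)
      ≡⟨ sym (lookup-⊙ M (N ⊙ v) i) ⟩
    lookup (M ⊙ (N ⊙ v)) i ∎

  IM-⊙ : ∀ v → IM ⊙ v ≡ v
  IM-⊙ v = ≡-by-lookup λ i → begin
    lookup (IM ⊙ v) i                       ≡⟨ lookup-⊙ IM v i ⟩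
    sum (λ j → entry IM i j *z lookup v j)  ≡⟨ sum-cong-≗ (λ j → cong (_*z lookup v j) (entry-IM i j)) ⟩
    sum (λ j → δ i j *z lookup v j)         ≡⟨ sum-δ i (lookup v) ⟩
    lookup v i                              ∎

  basis : Fin d → V
  basis j = tabulate (δ j)

  lookup-⊙-basis : ∀ M i j → lookup (M ⊙ basis j) i ≡ entry M i j
  lookup-⊙-basis M i j = begin
    lookup (M ⊙ basis j) i
      ≡⟨ lookup-⊙ M (basis j) i ⟩
    sum (λ k → entry M i k *z lookup (basis j) k)
      ≡⟨ sum-cong-≗ (λ k → trans (cong (entry M i k *z_) (lookup∘tabulate (δ j) k)) (*z-comm (entry M i k) (δ j k))) ⟩
    sum (λ k → δ j k *z entry M i k)
      ≡⟨ sum-δ j (entry M i) ⟩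
    entry M i j ∎

  ⊙-injective : ∀ M N → (∀ v → M ⊙ v ≡ N ⊙ v) → M ≡ N
  ⊙-injective M N eq = ≡-by-lookup λ i → ≡-by-lookup λ j →
    trans (sym (lookup-⊙-basis M i j)) (trans (cong (λ w → lookup w i) (eq (basis j))) (lookup-⊙-basis N i j))

  acts-trivially⇒≡IM : ∀ M → (∀ v → M ⊙ v ≡ v) → M ≡ IM
  acts-trivially⇒≡IM M triv = ⊙-injective M IM (λ v → trans (triv v) (sym (IM-⊙ v)))

  open import Algebra.Definitions.RawMonoid (AbelianGroup.rawMonoid abelianGroup) public using () renaming (_×_ to _×V_)

  lookup-×V : ∀ k v i → lookup (k ×V v) i ≡ reduce k *z lookup v i
  lookup-×V zero    v i = trans (lookup-replicate i 0z) (sym (zeroˡ (lookup v i)))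
  lookup-×V (suc k) v i = begin
    lookup (v +V (k ×V v)) i               ≡⟨ lookup-zipWith _+z_ i v (k ×V v) ⟩
    lookup v i +z lookup (k ×V v) i        ≡⟨ cong (lookup v i +z_) (lookup-×V k v i) ⟩
    lookup v i +z (reduce k *z lookup v i) ≡⟨ sym (reduce-suc-* k (lookup v i)) ⟩
    reduce (suc k) *z lookup v i           ∎

  •V-additive : ∀ c → IsAdditive (c •V_)
  •V-additive c u w = ≡-by-lookup λ i → begin
    lookup (c •V (u +V w)) i                    ≡⟨ lookup-map i (c *z_) (u +V w) ⟩
    c *z lookup (u +V w) i                      ≡⟨ cong (c *z_) (lookup-zipWith _+z_ i u w) ⟩
    c *z (lookup u i +z lookup w i)             ≡⟨ *z-distribˡ-+z c (lookup u i) (lookup w i) ⟩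
    (c *z lookup u i) +z (c *z lookup w i)      ≡⟨ sym (cong₂ _+z_ (lookup-map i (c *z_) u) (lookup-map i (c *z_) w)) ⟩
    lookup (c •V u) i +z lookup (c •V w) i      ≡⟨ sym (lookup-zipWith _+z_ i (c •V u) (c •V w)) ⟩
    lookup ((c •V u) +V (c •V w)) i             ∎

  ⊙-0V : ∀ M → M ⊙ 0V ≡ 0V
  ⊙-0V M = additive⇒0V (⊙-distrib-+V M)

  ⊙--V : ∀ M v → M ⊙ (-V v) ≡ -V (M ⊙ v)
  ⊙--V M = additive⇒-V (⊙-distrib-+V M)

  invertible-idempotent⇒acts-trivially : ∀ M → Invertible M → (∀ v → M ⊙ (M ⊙ v) ≡ M ⊙ v) → ∀ v → M ⊙ v ≡ v
  invertible-idempotent⇒acts-trivially M (N , _ , NM≡IM) idem v = begin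
    M ⊙ v              ≡⟨ sym (IM-⊙ (M ⊙ v)) ⟩
    IM ⊙ (M ⊙ v)       ≡⟨ cong (_⊙ (M ⊙ v)) (sym NM≡IM) ⟩
    (N ·M M) ⊙ (M ⊙ v) ≡⟨ ·M-⊙ N M (M ⊙ v) ⟩
    N ⊙ (M ⊙ (M ⊙ v))  ≡⟨ cong (N ⊙_) (idem v) ⟩
    N ⊙ (M ⊙ v)        ≡⟨ sym (·M-⊙ N M v) ⟩
    (N ·M M) ⊙ v       ≡⟨ cong (_⊙ v) NM≡IM ⟩
    IM ⊙ v             ≡⟨ IM-⊙ v ⟩
    v                  ∎

  coboundary : {X : Set} → (X → Mat) → V → X → V
  coboundary A v g = v +V (-V (A g ⊙ v))

  coboundary-additive : ∀ {X : Set} (A : X → Mat) g → IsAdditive (λ v → coboundary A v g)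
  coboundary-additive A g u w = begin
    (u +V w) +V (-V (A g ⊙ (u +V w)))              ≡⟨ cong (λ x → (u +V w) +V (-V x)) (⊙-distrib-+V (A g) u w) ⟩
    (u +V w) +V (-V ((A g ⊙ u) +V (A g ⊙ w)))       ≡⟨ cong ((u +V w) +V_) (sym (⁻¹-∙-comm (A g ⊙ u) (A g ⊙ w))) ⟩
    (u +V w) +V ((-V (A g ⊙ u)) +V (-V (A g ⊙ w)))  ≡⟨ interchange u w (-V (A g ⊙ u)) (-V (A g ⊙ w)) ⟩
    coboundary A u g +V coboundary A w g           ∎
    where
    open import Algebra.Properties.AbelianGroup abelianGroup using (⁻¹-∙-comm)
    open import Algebra.Properties.CommutativeSemigroup (AbelianGroup.commutativeSemigroup abelianGroup) using (interchange)

  coboundary-vanishes⇒fixed : ∀ {X : Set} (A : X → Mat) v g → coboundary A v g ≡ 0V → A g ⊙ v ≡ v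
  coboundary-vanishes⇒fixed A v g δ≡0 = sym (x∙y⁻¹≈ε⇒x≈y v (A g ⊙ v) δ≡0)

module NormalizerProperties (p : ℕ) .{{_ : NonZero p}} (d : ℕ) (r : ℕ) .{{_ : NonZero r}}
                            (ψ : Dihedral.Dih r → LinAlg.Mat p d) where
  open SemiDirect p d r ψ

  NormD-isSubgroup : IsSubgroupA NormD
  NormD-isSubgroup = ((λ g → g , refl) , (λ h → h , refl)) , NormD-∘A , NormD-invA
    where
    NormD-∘A : ∀ a b → NormD a → NormD b → NormD (a ∘A b)
    NormD-∘A a b (a-into , a-onto) (b-into , b-onto) =
      (λ g → let (h , bg≡h) = b-into g ; (k , ah≡k) = a-into h in k , trans (cong (fun a) bg≡h) ah≡k) ,
      (λ k → let (h , ah≡k) = a-onto k ; (g , bg≡h) = b-onto h in g , trans (cong (fun a) bg≡h) ah≡k)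
    NormD-invA : ∀ a → NormD a → NormD (invA a)
    NormD-invA a (a-into , a-onto) =
      (λ h → let (g , ag≡h) = a-onto h in g , trans (cong (inv a) (sym ag≡h)) (inv-fun a (ιD g))) ,
      (λ g → let (h , ag≡h) = a-into g in h , trans (cong (inv a) (sym ag≡h)) (inv-fun a (ιD g)))

module SemidirectProperties (p : ℕ) .{{_ : NonZero p}} (d : ℕ) (r : ℕ) .{{_ : NonZero r}}
                            (ψ : Dihedral.Dih r → LinAlg.Mat p d) (ψ-hom : Rep.IsHomToGL p d r ψ) where
  open LinAlg p d
  open LinAlgProperties p d
  open Dihedral r
  open DihedralProperties r
  open SemiDirect p d r ψ
  open ≡-Reasoning

  open import Algebra.Properties.CommutativeSemigroup (AbelianGroup.commutativeSemigroup abelianGroup)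
    using (interchange; xy∙z≈y∙xz; x∙yz≈xz∙y)

  ψ-⊙-·D : ∀ g h v → ψ (g ·D h) ⊙ v ≡ ψ g ⊙ (ψ h ⊙ v)
  ψ-⊙-·D g h v = trans (cong (_⊙ v) (proj₂ ψ-hom g h)) (·M-⊙ (ψ g) (ψ h) v)

  ψ-eD-⊙ : ∀ v → ψ eD ⊙ v ≡ v
  ψ-eD-⊙ = invertible-idempotent⇒acts-trivially (ψ eD) (proj₁ ψ-hom eD)
    (λ v → trans (sym (ψ-⊙-·D eD eD v)) (cong (λ g → ψ g ⊙ v) (·D-identityˡ eD)))

  ιV-· : ∀ u w → ιV u · ιV w ≡ ιV (u +V w)
  ιV-· u w = cong₂ _,_ (cong (u +V_) (ψ-eD-⊙ w)) (·D-identityˡ eD)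

  ιD-· : ∀ g h → ιD g · ιD h ≡ ιD (g ·D h)
  ιD-· g h = cong (_, g ·D h) (trans (cong (0V +V_) (⊙-0V (ψ g))) (+V-identityˡ 0V))

  ιV-·-ιD : ∀ u g → ιV u · ιD g ≡ (u , g)
  ιV-·-ιD u g = cong₂ _,_ (trans (cong (u +V_) (ψ-eD-⊙ 0V)) (+V-identityʳ u)) (·D-identityˡ g)

  invG-ιV : ∀ v → invG (ιV v) ≡ ιV (-V v)
  invG-ιV v = cong₂ _,_ (cong -V_ (trans (cong (λ g → ψ g ⊙ v) invD-eD) (ψ-eD-⊙ v))) invD-eD

  coboundary-cocycle : ∀ v g h → coboundary ψ v (g ·D h) ≡ coboundary ψ v g +V (ψ g ⊙ coboundary ψ v h)
  coboundary-cocycle v g h = begin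
    v +V (-V (ψ (g ·D h) ⊙ v))
      ≡⟨ cong (λ x → v +V (-V x)) (ψ-⊙-·D g h v) ⟩
    v +V (-V (ψ g ⊙ (ψ h ⊙ v)))
      ≡⟨ sym (telescope v (ψ g ⊙ v) (-V (ψ g ⊙ (ψ h ⊙ v)))) ⟩
    coboundary ψ v g +V ((ψ g ⊙ v) +V (-V (ψ g ⊙ (ψ h ⊙ v))))
      ≡⟨ cong (λ x → coboundary ψ v g +V ((ψ g ⊙ v) +V x)) (sym (⊙--V (ψ g) (ψ h ⊙ v))) ⟩
    coboundary ψ v g +V ((ψ g ⊙ v) +V (ψ g ⊙ (-V (ψ h ⊙ v))))
      ≡⟨ cong (coboundary ψ v g +V_) (sym (⊙-distrib-+V (ψ g) v (-V (ψ h ⊙ v)))) ⟩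
    coboundary ψ v g +V (ψ g ⊙ coboundary ψ v h) ∎
    where
    open import Algebra.Properties.Group (AbelianGroup.group abelianGroup) using (\\-leftDividesʳ)
    telescope : ∀ a b c → (a +V (-V b)) +V (b +V c) ≡ a +V c
    telescope a b c = trans (+V-assoc a (-V b) (b +V c)) (cong (a +V_) (\\-leftDividesʳ b c))

  conjV : V → G → G
  conjV v (u , g) = (u +V coboundary ψ v g) , g

  conj-ιV : ∀ v x → conj (ιV v) x ≡ conjV v x
  conj-ιV v (u , g) = cong₂ _,_ first second
    where
    first : (v +V (ψ eD ⊙ u)) +V (ψ (eD ·D g) ⊙ (-V (ψ (invD eD) ⊙ v))) ≡ u +V coboundary ψ v g
    first = begin
      (v +V (ψ eD ⊙ u)) +V (ψ (eD ·D g) ⊙ (-V (ψ (invD eD) ⊙ v)))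
        ≡⟨ cong₂ (λ x h → (v +V x) +V (ψ h ⊙ (-V (ψ (invD eD) ⊙ v)))) (ψ-eD-⊙ u) (·D-identityˡ g) ⟩
      (v +V u) +V (ψ g ⊙ (-V (ψ (invD eD) ⊙ v)))
        ≡⟨ cong (λ x → (v +V u) +V (ψ g ⊙ (-V x))) (trans (cong (λ h → ψ h ⊙ v) invD-eD) (ψ-eD-⊙ v)) ⟩
      (v +V u) +V (ψ g ⊙ (-V v))
        ≡⟨ cong ((v +V u) +V_) (⊙--V (ψ g) v) ⟩
      (v +V u) +V (-V (ψ g ⊙ v))
        ≡⟨ xy∙z≈y∙xz v u (-V (ψ g ⊙ v)) ⟩
      u +V coboundary ψ v g ∎
    second : (eD ·D g) ·D invD eD ≡ g
    second = trans (cong ((eD ·D g) ·D_) invD-eD) (trans (·D-identityʳ (eD ·D g)) (·D-identityˡ g))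

  conjV-0V : ∀ x → conjV 0V x ≡ x
  conjV-0V (u , g) = cong (_, g) (trans (cong (u +V_) (additive⇒0V (coboundary-additive ψ g))) (+V-identityʳ u))

  conjV-+V : ∀ v w x → conjV (v +V w) x ≡ conjV v (conjV w x)
  conjV-+V v w (u , g) = cong (_, g) (trans (cong (u +V_) (coboundary-additive ψ g v w))
    (x∙yz≈xz∙y u (coboundary ψ v g) (coboundary ψ w g)))

  conjV-cancel : ∀ v w → v +V w ≡ 0V → ∀ x → conjV v (conjV w x) ≡ x
  conjV-cancel v w v+w≡0 x = trans (sym (conjV-+V v w x)) (trans (cong (λ t → conjV t x) v+w≡0) (conjV-0V x))

  conjV-· : ∀ v x y → conjV v (x · y) ≡ conjV v x · conjV v y
  conjV-· v (u , g) (w , h) = cong (_, g ·D h) (begin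
    (u +V (ψ g ⊙ w)) +V coboundary ψ v (g ·D h)
      ≡⟨ cong ((u +V (ψ g ⊙ w)) +V_) (coboundary-cocycle v g h) ⟩
    (u +V (ψ g ⊙ w)) +V (coboundary ψ v g +V (ψ g ⊙ coboundary ψ v h))
      ≡⟨ interchange u (ψ g ⊙ w) (coboundary ψ v g) (ψ g ⊙ coboundary ψ v h) ⟩
    (u +V coboundary ψ v g) +V ((ψ g ⊙ w) +V (ψ g ⊙ coboundary ψ v h))
      ≡⟨ cong ((u +V coboundary ψ v g) +V_) (sym (⊙-distrib-+V (ψ g) w (coboundary ψ v h))) ⟩
    (u +V coboundary ψ v g) +V (ψ g ⊙ (w +V coboundary ψ v h)) ∎)

  conjAut : V → Aut
  conjAut v = record
    { fun = conjV v
    ; inv = conjV (-V v)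
    ; inv-fun = conjV-cancel (-V v) v (+V-inverseˡ v)
    ; fun-inv = conjV-cancel v (-V v) (+V-inverseʳ v)
    ; hom = conjV-· v
    }

  conjAut∈InnV : ∀ v → InnV (conjAut v)
  conjAut∈InnV v = v , λ x → sym (conj-ιV v x)

  InnV-isSubgroup : IsSubgroupA InnV
  InnV-isSubgroup =
    (0V , λ x → trans (sym (conjV-0V x)) (sym (conj-ιV 0V x))) ,
    (λ a b (v , a≡) (w , b≡) → v +V w , λ x → begin
      fun a (fun b x)           ≡⟨ trans (a≡ (fun b x)) (conj-ιV v (fun b x)) ⟩
      conjV v (fun b x)         ≡⟨ cong (conjV v) (trans (b≡ x) (conj-ιV w x)) ⟩
      conjV v (conjV w x)       ≡⟨ sym (conjV-+V v w x) ⟩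
      conjV (v +V w) x          ≡⟨ sym (conj-ιV (v +V w) x) ⟩
      conj (ιV (v +V w)) x      ∎) ,
    (λ a (v , a≡) → -V v , λ x → begin
      inv a x                               ≡⟨ cong (inv a) (sym (conjV-cancel v (-V v) (+V-inverseʳ v) x)) ⟩
      inv a (conjV v (conjV (-V v) x))      ≡⟨ cong (inv a) (sym (trans (a≡ _) (conj-ιV v _))) ⟩
      inv a (fun a (conjV (-V v) x))        ≡⟨ inv-fun a _ ⟩
      conjV (-V v) x                        ≡⟨ sym (conj-ιV (-V v) x) ⟩
      conj (ιV (-V v)) x                    ∎)

module FixedVectors (p : ℕ) .{{_ : NonZero p}} (d : ℕ) (r : ℕ) .{{_ : NonZero r}}
                    (ψ : Dihedral.Dih r → LinAlg.Mat p d)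
                    (irreducible : Rep.Irreducible p d r ψ) (nontrivial : Rep.NonTrivial p d r ψ) where
  open LinAlg p d
  open LinAlgProperties p d

  Fixed : V → Set
  Fixed v = ∀ g → ψ g ⊙ v ≡ v

  Fixed-isSubspace : IsSubspace Fixed
  Fixed-isSubspace = record
    { zero∈    = λ g → ⊙-0V (ψ g)
    ; +-closed = λ u w fixed-u fixed-w g → trans (⊙-distrib-+V (ψ g) u w) (cong₂ _+V_ (fixed-u g) (fixed-w g))
    ; •-closed = λ c u fixed-u g → trans (⊙-•V (ψ g) c u) (cong (c •V_) (fixed-u g))
    }

  fixed⇒0V : ∀ v → Fixed v → v ≡ 0V
  fixed⇒0V v fixed-v with irreducible Fixed Fixed-isSubspace invariant
    where
    invariant : ∀ g w → Fixed w → Fixed (ψ g ⊙ w)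
    invariant g w fixed-w h = trans (cong (ψ h ⊙_) (fixed-w g)) (trans (fixed-w h) (sym (fixed-w g)))
  ... | inj₁ only-0V = only-0V v fixed-v
  ... | inj₂ everything = ⊥-elim (nontrivial (λ g → acts-trivially⇒≡IM (ψ g) (λ w → everything w g)))

module InnVProperties (p : ℕ) .{{_ : NonZero p}} (d : ℕ) (r : ℕ) .{{_ : NonZero r}}
                      (ψ : Dihedral.Dih r → LinAlg.Mat p d) (ψ-hom : Rep.IsHomToGL p d r ψ)
                      (irreducible : Rep.Irreducible p d r ψ) (nontrivial : Rep.NonTrivial p d r ψ) where
  open LinAlg p d
  open LinAlgProperties p d
  open SemiDirect p d r ψ
  open SemidirectProperties p d r ψ ψ-hom
  open FixedVectors p d r ψ irreducible nontrivial
  open import Algebra.Properties.Group (AbelianGroup.group abelianGroup) using (x∙y⁻¹≈ε⇒x≈y)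
  open ≡-Reasoning

  coboundary-vanishes⇒0V : ∀ v → (∀ g → coboundary ψ v g ≡ 0V) → v ≡ 0V
  coboundary-vanishes⇒0V v δ≡0 = fixed⇒0V v (λ g → coboundary-vanishes⇒fixed ψ v g (δ≡0 g))

  coboundary-of-conj : ∀ v g → proj₁ (conj (ιV v) (ιD g)) ≡ coboundary ψ v g
  coboundary-of-conj v g = trans (cong proj₁ (conj-ιV v (ιD g))) (+V-identityˡ (coboundary ψ v g))

  InnV∩NormD-trivial : ∀ a → InnV a → NormD a → a ≈A idA
  InnV∩NormD-trivial a (v , a≡) (into , _) x = begin
    fun a x            ≡⟨ trans (a≡ x) (conj-ιV v x) ⟩
    conjV v x          ≡⟨ cong (λ w → conjV w x) v≡0 ⟩
    conjV 0V x         ≡⟨ conjV-0V x ⟩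
    x                  ∎
    where
    v≡0 : v ≡ 0V
    v≡0 = coboundary-vanishes⇒0V v λ g → let (h , ag≡h) = into g in
      trans (sym (coboundary-of-conj v g)) (cong proj₁ (trans (sym (a≡ (ιD g))) ag≡h))

  conjAut-injective : ∀ v w → conjAut v ≈A conjAut w → v ≡ w
  conjAut-injective v w v≈w = x∙y⁻¹≈ε⇒x≈y v w (coboundary-vanishes⇒0V (v +V (-V w)) λ g → begin
    coboundary ψ (v +V (-V w)) g                    ≡⟨ coboundary-additive ψ g v (-V w) ⟩
    coboundary ψ v g +V coboundary ψ (-V w) g       ≡⟨ cong₂ _+V_ (δ-agree g) (additive⇒-V (coboundary-additive ψ g) w) ⟩
    coboundary ψ w g +V (-V coboundary ψ w g)       ≡⟨ +V-inverseʳ (coboundary ψ w g) ⟩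
    0V                                             ∎)
    where
    δ-agree : ∀ g → coboundary ψ v g ≡ coboundary ψ w g
    δ-agree g = begin
      coboundary ψ v g             ≡⟨ sym (coboundary-of-conj v g) ⟩
      proj₁ (conj (ιV v) (ιD g))   ≡⟨ cong proj₁ (trans (conj-ιV v (ιD g)) (trans (v≈w (ιD g)) (sym (conj-ιV w (ιD g))))) ⟩
      proj₁ (conj (ιV w) (ιD g))   ≡⟨ coboundary-of-conj w g ⟩
      coboundary ψ w g             ∎

  InnV-isomorphic-to-V : InnV≅V
  InnV-isomorphic-to-V =
    conjAut ,
    (λ v w → conjV-+V v w) ,
    conjAut-injective ,
    conjAut∈InnV ,
    (λ a (v , a≡) → v , λ x → trans (a≡ x) (conj-ιV v x))

module AutomorphismsPreserveV (p : ℕ) .{{_ : NonZero p}} (d : ℕ) (r : ℕ) .{{_ : NonZero r}}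
                              (ψ : Dihedral.Dih r → LinAlg.Mat p d) (ψ-hom : Rep.IsHomToGL p d r ψ)
                              (p-odd : ∃[ q ] p ≡ suc (q * 2)) (p⊥r : Coprime p r) where
  open ZMod p
  open ZModProperties p
  open LinAlg p d
  open LinAlgProperties p d
  open Dihedral r
  open DihedralProperties r
  open SemiDirect p d r ψ
  open SemidirectProperties p d r ψ ψ-hom
  open CommutativeRing commutativeRing using (zeroˡ)
  open ≡-Reasoning

  p×V≡0V : ∀ v → p ×V v ≡ 0V
  p×V≡0V v = ≡-by-lookup λ i → begin
    lookup (p ×V v) i       ≡⟨ lookup-×V p v i ⟩
    reduce p *z lookup v i  ≡⟨ cong (_*z lookup v i) reduce-n ⟩
    0z *z lookup v i        ≡⟨ zeroˡ (lookup v i) ⟩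
    0z                      ≡⟨ sym (lookup-replicate i 0z) ⟩
    lookup 0V i             ∎

  ιV-power⁺ : ∀ v k → power⁺ _·_ (ιV v) k ≡ ιV (suc k ×V v)
  ιV-power⁺ v zero    = cong ιV (sym (+V-identityʳ v))
  ιV-power⁺ v (suc k) = trans (cong (ιV v ·_) (ιV-power⁺ v k)) (ιV-· v (suc k ×V v))

  aut-preserves-V : ∀ f v → proj₂ (fun f (ιV v)) ≡ eD
  aut-preserves-V f v = power⁺-fixed⇒eD p⊥r p-odd (proj₂ (fun f (ιV v))) (begin
    power⁺ _·D_ (proj₂ (fun f (ιV v))) p   ≡⟨ sym (power⁺-homo proj₂ (λ _ _ → refl) (fun f (ιV v)) p) ⟩
    proj₂ (power⁺ _·_ (fun f (ιV v)) p)    ≡⟨ cong proj₂ (sym (power⁺-homo (fun f) (hom f) (ιV v) p)) ⟩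
    proj₂ (fun f (power⁺ _·_ (ιV v) p))    ≡⟨ cong (λ x → proj₂ (fun f x)) ιV-power⁺-p ⟩
    proj₂ (fun f (ιV v))                   ∎)
    where
    ιV-power⁺-p : power⁺ _·_ (ιV v) p ≡ ιV v
    ιV-power⁺-p = trans (ιV-power⁺ v p) (cong ιV (trans (cong (v +V_) (p×V≡0V v)) (+V-identityʳ v)))

  restrictV : Aut → V → V
  restrictV f v = proj₁ (fun f (ιV v))

  fun-ιV : ∀ f v → fun f (ιV v) ≡ ιV (restrictV f v)
  fun-ιV f v = cong (restrictV f v ,_) (aut-preserves-V f v)

  restrictV-additive : ∀ f → IsAdditive (restrictV f)
  restrictV-additive f u w = cong proj₁ (begin
    fun f (ιV (u +V w))                      ≡⟨ cong (fun f) (sym (ιV-· u w)) ⟩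
    fun f (ιV u · ιV w)                      ≡⟨ hom f (ιV u) (ιV w) ⟩
    fun f (ιV u) · fun f (ιV w)              ≡⟨ cong₂ _·_ (fun-ιV f u) (fun-ιV f w) ⟩
    ιV (restrictV f u) · ιV (restrictV f w)  ≡⟨ ιV-· (restrictV f u) (restrictV f w) ⟩
    ιV (restrictV f u +V restrictV f w)      ∎)

  InnV-isNormal : IsNormalA InnV
  InnV-isNormal = InnV-isSubgroup , conjugate-InnV
    where
    conjugate-InnV : ∀ f a → InnV a → InnV ((f ∘A a) ∘A invA f)
    conjugate-InnV f a (v , a≡) = restrictV f v , λ x → begin
      fun f (fun a (inv f x))                                 ≡⟨ cong (fun f) (a≡ (inv f x)) ⟩
      fun f ((ιV v · inv f x) · invG (ιV v))                  ≡⟨ trans (hom f _ _) (cong₂ _·_ (hom f _ _) (cong (fun f) (invG-ιV v))) ⟩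
      (fun f (ιV v) · fun f (inv f x)) · fun f (ιV (-V v))    ≡⟨ cong₂ (λ y z → (y · z) · fun f (ιV (-V v))) (fun-ιV f v) (fun-inv f x) ⟩
      (ιV w · x) · fun f (ιV (-V v))                          ≡⟨ cong ((ιV w · x) ·_) (fun-ιV f (-V v)) ⟩
      (ιV w · x) · ιV (restrictV f (-V v))                    ≡⟨ cong (λ y → (ιV w · x) · ιV y) (additive⇒-V (restrictV-additive f) v) ⟩
      (ιV w · x) · ιV (-V w)                                  ≡⟨ cong ((ιV w · x) ·_) (sym (invG-ιV w)) ⟩
      conj (ιV w) x                                           ∎
      where
      w : V
      w = restrictV f v

module DihedralSums (p : ℕ) .{{_ : NonZero p}} (d : ℕ) (r : ℕ) .{{_ : NonZero r}} where
  open ZMod r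
  open ZModProperties r
  open LinAlg p d
  open LinAlgProperties p d
  open Dihedral r
  open import Algebra.Properties.CommutativeMonoid.Sum (AbelianGroup.commutativeMonoid abelianGroup)
    using (sum; sum-cong-≗; sum-replicate; ∑-distrib-+; ∑-permute)
  open import Algebra.Properties.CommutativeSemigroup (AbelianGroup.commutativeSemigroup abelianGroup)
    using (interchange)
  open import Algebra.Properties.Group (CommutativeRing.+-group commutativeRing) using (\\-leftDividesˡ; \\-leftDividesʳ)

  ΣD : (Dih → V) → V
  ΣD F = sum (λ j → F (j , false) +V F (j , true))

  ΣD-cong : ∀ {F H} → (∀ g → F g ≡ H g) → ΣD F ≡ ΣD H
  ΣD-cong F≗H = sum-cong-≗ (λ j → cong₂ _+V_ (F≗H (j , false)) (F≗H (j , true)))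

  ΣD-+V : ∀ F H → ΣD (λ g → F g +V H g) ≡ ΣD F +V ΣD H
  ΣD-+V F H = trans (sum-cong-≗ (λ j → interchange (F (j , false)) (H (j , false)) (F (j , true)) (H (j , true))))
    (∑-distrib-+ (λ j → F (j , false) +V F (j , true)) (λ j → H (j , false) +V H (j , true)))

  ΣD-const : ∀ w → ΣD (λ _ → w) ≡ r ×V (w +V w)
  ΣD-const w = sum-replicate r

  ⊙-ΣD : ∀ M F → M ⊙ ΣD F ≡ ΣD (λ g → M ⊙ F g)
  ⊙-ΣD M F = trans (⊙-sum (λ j → F (j , false) +V F (j , true)))
    (sum-cong-≗ (λ j → ⊙-distrib-+V M (F (j , false)) (F (j , true))))
    where
    ⊙-sum : ∀ {k} (F : Fin k → V) → M ⊙ sum F ≡ sum (λ j → M ⊙ F j)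
    ⊙-sum {zero}  F = ⊙-0V M
    ⊙-sum {suc k} F = trans (⊙-distrib-+V M (F Fin.zero) _) (cong ((M ⊙ F Fin.zero) +V_) (⊙-sum (λ j → F (Fin.suc j))))

  ΣD-translate : ∀ g F → ΣD (λ h → F (g ·D h)) ≡ ΣD F
  ΣD-translate (i , false) F = sym (∑-permute (λ j → F (j , false) +V F (j , true))
    (permutation (i +z_) ((-z i) +z_) (\\-leftDividesˡ i) (\\-leftDividesʳ i)))
  ΣD-translate (i , true) F = trans (sum-cong-≗ (λ j → +V-comm (F (i +z (-z j) , true)) (F (i +z (-z j) , false))))
    (sym (∑-permute (λ j → F (j , false) +V F (j , true))
      (permutation (λ j → i +z (-z j)) (λ j → i +z (-z j)) (x-[x-y]≡y i) (x-[x-y]≡y i))))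

module CocyclesAreCoboundaries (p : ℕ) .{{_ : NonZero p}} (d : ℕ) (r : ℕ) .{{_ : NonZero r}}
                               (2r⊥p : Coprime (2 * r) p) where
  open ZMod p
  open ZModProperties p
  open LinAlg p d
  open LinAlgProperties p d
  open Dihedral r
  open DihedralSums p d r
  open import Algebra.Properties.Group (AbelianGroup.group abelianGroup)
    using (\\-leftDividesˡ; \\-leftDividesʳ; ⁻¹-anti-homo-∙; ⁻¹-involutive)
  open ≡-Reasoning

  1/2r : Z
  1/2r = proj₁ (coprime⇒invertible 2r⊥p)

  1/2r-•V-r×V : ∀ w → 1/2r •V (r ×V (w +V w)) ≡ w
  1/2r-•V-r×V w = ≡-by-lookup λ i → let a = lookup w i in begin
    lookup (1/2r •V (r ×V (w +V w))) i
      ≡⟨ lookup-map i (1/2r *z_) (r ×V (w +V w)) ⟩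
    1/2r *z lookup (r ×V (w +V w)) i
      ≡⟨ cong (1/2r *z_) (trans (lookup-×V r (w +V w) i) (cong (reduce r *z_) (lookup-zipWith _+z_ i w w))) ⟩
    1/2r *z (reduce r *z (a +z a))
      ≡⟨ cong (1/2r *z_) (trans (*z-distribˡ-+z (reduce r) a a) (sym (*z-distribʳ-+z a (reduce r) (reduce r)))) ⟩
    1/2r *z ((reduce r +z reduce r) *z a)
      ≡⟨ cong (λ x → 1/2r *z (x *z a)) (trans (sym (reduce-+ r r)) (cong (λ k → reduce (r + k)) (sym (ℕ.+-identityʳ r)))) ⟩
    1/2r *z (reduce (2 * r) *z a)
      ≡⟨ sym (*z-assoc 1/2r (reduce (2 * r)) a) ⟩
    (1/2r *z reduce (2 * r)) *z a
      ≡⟨ cong (_*z a) (proj₂ (coprime⇒invertible 2r⊥p)) ⟩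
    1z *z a
      ≡⟨ *z-identityˡ a ⟩
    a ∎

  cocycle⇒coboundary : ∀ (A : Dih → Mat) (c : Dih → V) → (∀ g h → c (g ·D h) ≡ c g +V (A g ⊙ c h)) →
                       ∃[ v ] (∀ g → coboundary A v g ≡ c g)
  cocycle⇒coboundary A c cocycle = v , coboundary-v
    where
    v : V
    v = 1/2r •V ΣD c

    A-c : ∀ g h → A g ⊙ c h ≡ (-V c g) +V c (g ·D h)
    A-c g h = trans (sym (\\-leftDividesʳ (c g) (A g ⊙ c h))) (cong ((-V c g) +V_) (sym (cocycle g h)))

    A-ΣD : ∀ g → A g ⊙ ΣD c ≡ (r ×V ((-V c g) +V (-V c g))) +V ΣD c
    A-ΣD g = begin
      A g ⊙ ΣD c                                       ≡⟨ ⊙-ΣD (A g) c ⟩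
      ΣD (λ h → A g ⊙ c h)                             ≡⟨ ΣD-cong (A-c g) ⟩
      ΣD (λ h → (-V c g) +V c (g ·D h))                ≡⟨ ΣD-+V (λ _ → -V c g) (λ h → c (g ·D h)) ⟩
      ΣD (λ _ → -V c g) +V ΣD (λ h → c (g ·D h))       ≡⟨ cong₂ _+V_ (ΣD-const (-V c g)) (ΣD-translate g c) ⟩
      (r ×V ((-V c g) +V (-V c g))) +V ΣD c            ∎

    A-v : ∀ g → A g ⊙ v ≡ (-V c g) +V v
    A-v g = begin
      A g ⊙ (1/2r •V ΣD c)                                          ≡⟨ ⊙-•V (A g) 1/2r (ΣD c) ⟩
      1/2r •V (A g ⊙ ΣD c)                                          ≡⟨ cong (1/2r •V_) (A-ΣD g) ⟩
      1/2r •V ((r ×V ((-V c g) +V (-V c g))) +V ΣD c)              ≡⟨ •V-additive 1/2r _ (ΣD c) ⟩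
      (1/2r •V (r ×V ((-V c g) +V (-V c g)))) +V v                 ≡⟨ cong (_+V v) (1/2r-•V-r×V (-V c g)) ⟩
      (-V c g) +V v                                                 ∎

    coboundary-v : ∀ g → coboundary A v g ≡ c g
    coboundary-v g = begin
      v +V (-V (A g ⊙ v))            ≡⟨ cong (λ x → v +V (-V x)) (A-v g) ⟩
      v +V (-V ((-V c g) +V v))      ≡⟨ cong (v +V_) (⁻¹-anti-homo-∙ (-V c g) v) ⟩
      v +V ((-V v) +V (-V (-V c g))) ≡⟨ \\-leftDividesˡ v (-V (-V c g)) ⟩
      -V (-V c g)                    ≡⟨ ⁻¹-involutive (c g) ⟩
      c g                            ∎

module InnV-NormD-Factorisation (p : ℕ) .{{_ : NonZero p}} (d : ℕ) (r : ℕ) .{{_ : NonZero r}}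
                                (ψ : Dihedral.Dih r → LinAlg.Mat p d) (ψ-hom : Rep.IsHomToGL p d r ψ)
                                (p-odd : ∃[ q ] p ≡ suc (q * 2)) (p⊥r : Coprime p r) (2r⊥p : Coprime (2 * r) p) where
  open LinAlg p d
  open LinAlgProperties p d
  open Dihedral r
  open DihedralProperties r
  open SemiDirect p d r ψ
  open SemidirectProperties p d r ψ ψ-hom
  open AutomorphismsPreserveV p d r ψ ψ-hom p-odd p⊥r
  open CocyclesAreCoboundaries p d r 2r⊥p
  open ≡-Reasoning

  factorisation : ∀ f → Σ Aut (λ a → Σ Aut (λ b → InnV a × NormD b × (f ≈A (a ∘A b))))
  factorisation f = conjAut v , b , conjAut∈InnV v , ((λ g → φ g , b-ιD g) , b-onto) , f≈v∘b
    where
    c : Dih → V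
    c g = proj₁ (fun f (ιD g))
    φ : Dih → Dih
    φ g = proj₂ (fun f (ιD g))

    c-cocycle : ∀ g h → c (g ·D h) ≡ c g +V (ψ (φ g) ⊙ c h)
    c-cocycle g h = cong proj₁ (trans (cong (fun f) (sym (ιD-· g h))) (hom f (ιD g) (ιD h)))

    c-coboundary : ∃[ v ] (∀ g → coboundary (λ g → ψ (φ g)) v g ≡ c g)
    c-coboundary = cocycle⇒coboundary (λ g → ψ (φ g)) c c-cocycle

    v : V
    v = proj₁ c-coboundary

    b : Aut
    b = conjAut (-V v) ∘A f

    b-ιD : ∀ g → fun b (ιD g) ≡ ιD (φ g)
    b-ιD g = cong (_, φ g) (begin
      c g +V coboundary ψ (-V v) (φ g)   ≡⟨ cong (c g +V_) (additive⇒-V (coboundary-additive ψ (φ g)) v) ⟩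
      c g +V (-V coboundary ψ v (φ g))   ≡⟨ cong (λ x → c g +V (-V x)) (proj₂ c-coboundary g) ⟩
      c g +V (-V c g)                    ≡⟨ +V-inverseʳ (c g) ⟩
      0V                                 ∎)

    b-onto : ∀ h → ∃[ g ] fun b (ιD g) ≡ ιD h
    b-onto h = k , trans (b-ιD k) (cong ιD (sym h≡φk))
      where
      u : V
      u = proj₁ (inv b (ιD h))
      k : Dih
      k = proj₂ (inv b (ιD h))
      h≡φk : h ≡ φ k
      h≡φk = trans (cong proj₂ (begin
        ιD h                                 ≡⟨ sym (fun-inv b (ιD h)) ⟩
        fun b (inv b (ιD h))                 ≡⟨ cong (fun b) (sym (ιV-·-ιD u k)) ⟩
        fun b (ιV u · ιD k)                  ≡⟨ hom b (ιV u) (ιD k) ⟩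
        fun b (ιV u) · fun b (ιD k)          ≡⟨ cong₂ _·_ (fun-ιV b u) (b-ιD k) ⟩
        ιV (restrictV b u) · ιD (φ k)        ∎)) (·D-identityˡ (φ k))

    f≈v∘b : f ≈A (conjAut v ∘A b)
    f≈v∘b x = sym (conjV-cancel v (-V v) (+V-inverseʳ v) (fun f x))

lemma5p1 : (p : ℕ) .{{_ : NonZero p}} → Prime p → ¬ (p ≡ 2) →
    (r : ℕ) .{{_ : NonZero r}} → 3 ≤ r → ¬ (p ∣ r) →
    (d : ℕ) → (ψ : Dihedral.Dih r → LinAlg.Mat p d) →
    ¬ (p ∣ 2 * r) →
    Rep.IsHomToGL p d r ψ → Rep.Irreducible p d r ψ → Rep.NonTrivial p d r ψ →
    SemiDirect.IsSemidirectA p d r ψ (SemiDirect.InnV p d r ψ) (SemiDirect.NormD p d r ψ)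
      × SemiDirect.InnV≅V p d r ψ
lemma5p1 p p-prime p≢2 r _ p∤r d ψ p∤2r ψ-hom irreducible nontrivial =
  (InnV-isNormal , NormD-isSubgroup , InnV∩NormD-trivial , factorisation) , InnV-isomorphic-to-V
  where
  p-odd : ∃[ q ] p ≡ suc (q * 2)
  p-odd = odd-prime p-prime p≢2
  p⊥r : Coprime p r
  p⊥r = prime∤⇒coprime p-prime p∤r
  2r⊥p : Coprime (2 * r) p
  2r⊥p = Coprime.sym (prime∤⇒coprime p-prime p∤2r)
  open NormalizerProperties p d r ψ using (NormD-isSubgroup)
  open InnVProperties p d r ψ ψ-hom irreducible nontrivial using (InnV∩NormD-trivial; InnV-isomorphic-to-V)
  open AutomorphismsPreserveV p d r ψ ψ-hom p-odd p⊥r using (InnV-isNormal)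
  open InnV-NormD-Factorisation p d r ψ ψ-hom p-odd p⊥r 2r⊥p using (factorisation)
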